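{- For every $k\in\mathbb{N}$ there exists a Boolean function $f:\{0,1\}^{(4k+2)(3k+2)}\to\{0,1\}$ such that $s(f)=3k+2$ and $bs(f)=(3k+2)(2k+1)$. In particular, $bs(f)=\frac{2}{3}s(f)^2-\frac{1}{3}s(f)$.
   Context: For $f:\{0,1\}^n\to\{0,1\}$ and $x\in\{0,1\}^n$, let $x^{(i)}$ be $x$ with its $i$-th bit flipped, and for $B\subseteq[n]$ let $x^{(B)}$ be $x$ with all bits indexed by $B$ flipped. The sensitivity of $f$ at $x$ is $s(f,x)=|\{i\in[n]: f(x^{(i)})\neq f(x)\}|$, and $s(f)=\max_x s(f,x)$. The block sensitivity $bs(f,x)$ is the maximum number $b$ of pairwise disjoint subsets $B_1,\dots,B_b\subseteq[n]$ with $f(x^{(B_i)})\neq f(x)$ for all $i$, and $bs(f)=\max_x bs(f,x)$. -}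

module Defs where

open import Data.Nat using (ℕ; _≤_)
open import Data.Bool using (Bool; not; _xor_)
open import Data.Vec using (Vec; updateAt; zipWith; tabulate)
open import Data.Fin using (Fin)
open import Data.Fin.Subset using (Subset; ∣_∣; _∩_; ⊥)
open import Data.Product using (Σ; _×_; ∃)
open import Relation.Binary.PropositionalEquality using (_≡_; _≢_)

-- Inputs are bit vectors x ∈ {0,1}^n, encoded as Vec Bool n (false = 0, true = 1).
BoolFun : ℕ → Set
BoolFun n = Vec Bool n → Bool

flipBit : ∀ {n} → Vec Bool n → Fin n → Vec Bool n
flipBit x i = updateAt x i not

flipBlock : ∀ {n} → Vec Bool n → Subset n → Vec Bool n
flipBlock x B = zipWith _xor_ x B

sensitiveSet : ∀ {n} → BoolFun n → Vec Bool n → Subset n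
sensitiveSet f x = tabulate (λ i → f (flipBit x i) xor f x)

sensAt : ∀ {n} → BoolFun n → Vec Bool n → ℕ
sensAt f x = ∣ sensitiveSet f x ∣

IsMax : (ℕ → Set) → ℕ → Set
IsMax P m = P m × (∀ k → P k → k ≤ m)

SensitivityIs : ∀ {n} → BoolFun n → ℕ → Set
SensitivityIs {n} f = IsMax (λ m → Σ (Vec Bool n) (λ x → sensAt f x ≡ m))

SensitiveBlocks : ∀ {n} → BoolFun n → Vec Bool n → ℕ → Set
SensitiveBlocks {n} f x b =
  Σ (Fin b → Subset n) (λ B →
    (∀ i j → i ≢ j → B i ∩ B j ≡ ⊥) ×
    (∀ i → f (flipBlock x (B i)) ≢ f x))

BlockSensitivityAtIs : ∀ {n} → BoolFun n → Vec Bool n → ℕ → Set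
BlockSensitivityAtIs f x = IsMax (SensitiveBlocks f x)

BlockSensitivityIs : ∀ {n} → BoolFun n → ℕ → Set
BlockSensitivityIs {n} f = IsMax (λ m → Σ (Vec Bool n) (λ x → BlockSensitivityAtIs f x m))

-- The function is an OR of subcubes. Take 3k+2 disjoint copies of 4k+2 variables x(c,p,b), with
-- p ∈ ℤ/(2k+1) and b ∈ {0,1}, and the rotational tournament in which p beats p, p+1, …, p+k. The cube
-- of (c,i) fixes x(c,p,1) = [p = i] for every p and x(c,p,0) = [p = i] for the k+1 players beaten by i,
-- so it has codimension 3k+2, which bounds both s and bs at every 1-input. Two cubes of the same copy
-- disagree on at least three coordinates, so at a 0-input each copy holds at most one sensitive
-- coordinate and s(f) ≤ 3k+2; equality holds at the indicator of a single pair (c,i), which is two flips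
-- away from every other cube. At a 0-input every sensitive block contains a fixed coordinate on which x
-- disagrees with the cube the block flips into, so disjoint sensitive blocks flip into distinct cubes and
-- bs(f) ≤ (3k+2)(2k+1); the pairs {x(c,i,0), x(c,i,1)} attain this at the all-zero input.

module Submission where

open import Defs
open import Data.Nat using (ℕ; suc; _+_; _*_; _∸_; _≤_; _<_; s≤s; _≤?_)
open import Data.Nat.Properties
  using (m+[n∸m]≡n; m+n∸m≡n; +-assoc; +-identityʳ; <⇒≤; ≰⇒>; ∸-monoʳ-≤; m∸n≤m; ≤-trans; ≤-reflexive;
         ≤-antisym; <-trans; <-≤-trans; <-cmp; m≤m+n; m≤m*n)
open import Data.Nat.DivMod using (_%_; m%n<n; m<n⇒m%n≡m; [m+n]%n≡m%n)
open import Data.Nat.Tactic.RingSolver using (solve-∀)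
open import Data.Bool using (Bool; true; false; not; _xor_)
open import Data.Bool.Properties using (not-¬; xor-identityˡ; xor-identityʳ)
import Data.Bool.Properties as Bool
open import Data.Vec using (Vec; _∷_; lookup; tabulate; replicate; here; there)
open import Data.Vec.Properties
  using (lookup∘updateAt; lookup∘updateAt′; lookup-zipWith; lookup∘tabulate; lookup-replicate;
         lookup⇒[]=; []=⇒lookup; zipWith-identityˡ)
open import Data.Fin using (Fin; zero; suc; toℕ; fromℕ<; cast; combine; remQuot; splitAt; join; _≟_)
open import Data.Fin.Patterns using (0F; 1F)
open import Data.Fin.Properties
  using (suc-injective; toℕ-injective; toℕ-fromℕ<; toℕ<n; injective⇒≤; any?; all?; ¬∀⟶∃¬; cast-involutive;
         combine-injective; remQuot-combine; combine-remQuot; splitAt-join; join-splitAt)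
open import Data.Fin.Subset using (Subset; ∣_∣; _∈_; _∩_; inside; outside) renaming (⊥ to ∅)
open import Data.Fin.Subset.Properties using (x∈p∩q⁺; x∈p∩q⁻; ∉⊥; Empty-unique)
open import Data.Product using (Σ; ∃; ∃₂; _×_; _,_; proj₁; proj₂; map₂; uncurry)
open import Data.Product.Properties using (≡-dec)
open import Data.Sum using (_⊎_; inj₁; inj₂; [_,_]′; swap) renaming (map to ⊎-map)
open import Function using (_∘_)
open import Function.Bundles using (mk⇔)
open import Function.Definitions using (Injective)
open import Relation.Binary.Definitions using (DecidableEquality; tri<; tri≈; tri>)
open import Relation.Binary.PropositionalEquality
open import Relation.Nullary using (¬_; Dec; yes; no; does; proof; contradiction)
open import Relation.Nullary.Reflects using (Reflects; invert)
open import Relation.Nullary.Decidable using (map′; _×-dec_; _⊎-dec_; _→-dec_; dec-true; dec-false; does-⇔)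

member : ∀ {n} (p : Subset n) → Fin ∣ p ∣ → Fin n
member (inside  ∷ p) zero    = zero
member (inside  ∷ p) (suc t) = suc (member p t)
member (outside ∷ p) t       = suc (member p t)

member-∈ : ∀ {n} (p : Subset n) t → member p t ∈ p
member-∈ (inside  ∷ p) zero    = here
member-∈ (inside  ∷ p) (suc t) = there (member-∈ p t)
member-∈ (outside ∷ p) t       = there (member-∈ p t)

member-injective : ∀ {n} (p : Subset n) → Injective _≡_ _≡_ (member p)
member-injective (inside  ∷ p) {zero}  {zero}  _  = refl
member-injective (inside  ∷ p) {suc t} {suc u} eq = cong suc (member-injective p (suc-injective eq))
member-injective (outside ∷ p) eq = member-injective p (suc-injective eq)

rank : ∀ {n} {p : Subset n} {x} → x ∈ p → Fin ∣ p ∣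
rank {p = inside  ∷ p} here        = zero
rank {p = inside  ∷ p} (there x∈p) = suc (rank x∈p)
rank {p = outside ∷ p} (there x∈p) = rank x∈p

member-rank : ∀ {n} {p : Subset n} {x} (x∈p : x ∈ p) → member p (rank x∈p) ≡ x
member-rank {p = inside  ∷ p} here        = refl
member-rank {p = inside  ∷ p} (there x∈p) = cong suc (member-rank x∈p)
member-rank {p = outside ∷ p} (there x∈p) = cong suc (member-rank x∈p)

injectiveOn⇒∣p∣≤ : ∀ {n m} (p : Subset n) (h : Fin n → Fin m) →
  (∀ {x y} → x ∈ p → y ∈ p → h x ≡ h y → x ≡ y) → ∣ p ∣ ≤ m
injectiveOn⇒∣p∣≤ p h inj = injective⇒≤ λ eq →
  member-injective p (inj (member-∈ p _) (member-∈ p _) eq)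

coveredBy⇒∣p∣≤ : ∀ {n m} (p : Subset n) (e : Fin m → Fin n) →
  (∀ {x} → x ∈ p → ∃ λ u → e u ≡ x) → ∣ p ∣ ≤ m
coveredBy⇒∣p∣≤ p e cover = injective⇒≤ {f = preimage} λ {t} {u} eq →
  member-injective p (trans (sym (covers t)) (trans (cong e eq) (covers u)))
  where
  preimage : Fin ∣ p ∣ → _
  preimage t = proj₁ (cover (member-∈ p t))
  covers : ∀ t → e (preimage t) ≡ member p t
  covers t = proj₂ (cover (member-∈ p t))

injectiveInto⇒≤∣p∣ : ∀ {n m} (p : Subset n) (e : Fin m → Fin n) →
  Injective _≡_ _≡_ e → (∀ u → e u ∈ p) → m ≤ ∣ p ∣
injectiveInto⇒≤∣p∣ p e inj e∈p = injective⇒≤ {f = λ u → rank (e∈p u)} λ {u} {v} eq →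
  inj (trans (sym (member-rank (e∈p u))) (trans (cong (member p) eq) (member-rank (e∈p v))))

disjoint⇒injective : ∀ {n b} {A : Set} (B : Fin b → Subset n) →
  (∀ t t' → t ≢ t' → B t ∩ B t' ≡ ∅) →
  (g : Fin b → A) (q : A → Fin n) → (∀ t → q (g t) ∈ B t) → Injective _≡_ _≡_ g
disjoint⇒injective B disjoint g q q∈B {t} {t'} eq with t ≟ t'
... | yes t≡t' = t≡t'
... | no  t≢t' = contradiction (subst (_ ∈_) (disjoint t t' t≢t')
                   (x∈p∩q⁺ (q∈B t , subst (λ a → q a ∈ B t') (sym eq) (q∈B t')))) ∉⊥

avoid-two : ∀ {A : Set} {P : A → Set} → DecidableEquality A → ∀ {a b c} →
  a ≢ b → a ≢ c → b ≢ c → P a → P b → P c → ∀ j j' → ∃ λ q → P q × q ≢ j × q ≢ j'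
avoid-two eq? {a} {b} {c} a≢b a≢c b≢c pa pb pc j j' with eq? a j | eq? a j' | eq? b j | eq? b j'
... | no a≢j | no a≢j' | _        | _        = a , pa , a≢j , a≢j'
... | yes refl | _     | _        | no b≢j'  = b , pb , a≢b ∘ sym , b≢j'
... | yes refl | _     | _        | yes refl = c , pc , a≢c ∘ sym , b≢c ∘ sym
... | no _   | yes refl | no b≢j  | _        = b , pb , b≢j , a≢b ∘ sym
... | no _   | yes refl | yes refl | _       = c , pc , b≢c ∘ sym , a≢c ∘ sym

module _ {n : ℕ} where

  lookup-flipBit-≡ : ∀ (x : Vec Bool n) j → lookup (flipBit x j) j ≡ not (lookup x j)
  lookup-flipBit-≡ x j = lookup∘updateAt j x

  lookup-flipBit-≢ : ∀ (x : Vec Bool n) {j q} → q ≢ j → lookup (flipBit x j) q ≡ lookup x q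
  lookup-flipBit-≢ x q≢j = lookup∘updateAt′ _ _ q≢j x

  changedBy-flipBit : ∀ (x : Vec Bool n) {j q} → lookup (flipBit x j) q ≢ lookup x q → q ≡ j
  changedBy-flipBit x {j} {q} changed with q ≟ j
  ... | yes q≡j = q≡j
  ... | no  q≢j = contradiction (lookup-flipBit-≢ x q≢j) changed

  changedBy-flipBlock : ∀ (x : Vec Bool n) (B : Subset n) {q} →
    lookup (flipBlock x B) q ≢ lookup x q → q ∈ B
  changedBy-flipBlock x B {q} changed with lookup B q in eq
  ... | true  = lookup⇒[]= q B eq
  ... | false = contradiction (trans (lookup-zipWith _xor_ q x B)
                  (trans (cong (lookup x q xor_) eq) (xor-identityʳ _))) changed

  j∈sensitiveSet⁺ : ∀ (f : BoolFun n) x {j} → f (flipBit x j) ≢ f x → j ∈ sensitiveSet f x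
  j∈sensitiveSet⁺ f x {j} f≢ = lookup⇒[]= j _ (trans (lookup∘tabulate _ j) (≢⇒xor≡true f≢))
    where
    ≢⇒xor≡true : ∀ {a b} → a ≢ b → a xor b ≡ true
    ≢⇒xor≡true {false} {false} a≢b = contradiction refl a≢b
    ≢⇒xor≡true {false} {true}  _   = refl
    ≢⇒xor≡true {true}  {false} _   = refl
    ≢⇒xor≡true {true}  {true}  a≢b = contradiction refl a≢b

  j∈sensitiveSet⁻ : ∀ (f : BoolFun n) x {j} → j ∈ sensitiveSet f x → f (flipBit x j) ≢ f x
  j∈sensitiveSet⁻ f x {j} j∈S = xor≡true⇒≢ (trans (sym (lookup∘tabulate _ j)) ([]=⇒lookup j∈S))
    where
    xor≡true⇒≢ : ∀ {a b} → a xor b ≡ true → a ≢ b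
    xor≡true⇒≢ {false} {false} ()
    xor≡true⇒≢ {true}  {true}  ()
    xor≡true⇒≢ {false} {true}  _ ()
    xor≡true⇒≢ {true}  {false} _ ()

  sensitivity-intro : ∀ {f : BoolFun n} {m} x → sensAt f x ≡ m →
    (∀ y → sensAt f y ≤ m) → SensitivityIs f m
  sensitivity-intro x attained bound = (x , attained) , λ { _ (y , refl) → bound y }

  blockSensitivity-intro : ∀ {f : BoolFun n} {m} x → SensitiveBlocks f x m →
    (∀ y {b} → SensitiveBlocks f y b → b ≤ m) → BlockSensitivityIs f m
  blockSensitivity-intro x attained bound =
    (x , attained , λ _ → bound x) , λ { _ (y , blocks , _) → bound y blocks }

module Subcubes {n G L : ℕ}
  (Fixed : Fin G × Fin L → Fin n → Set)
  (fixed? : ∀ ι j → Dec (Fixed ι j))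
  (value : Fin G × Fin L → Fin n → Bool)
  where

  Index : Set
  Index = Fin G × Fin L

  _≟ᶜ_ : (ι ι' : Index) → Dec (ι ≡ ι')
  _≟ᶜ_ = ≡-dec _≟_ _≟_

  record _∈ᶜ_ (x : Vec Bool n) (ι : Index) : Set where
    constructor agrees
    field agreement : ∀ j → Fixed ι j → lookup x j ≡ value ι j
  open _∈ᶜ_

  _∈ᶜ?_ : ∀ x ι → Dec (x ∈ᶜ ι)
  x ∈ᶜ? ι = map′ agrees agreement (all? λ j → fixed? ι j →-dec (lookup x j Bool.≟ value ι j))

  Covered : Vec Bool n → Set
  Covered x = ∃ (x ∈ᶜ_)

  covered? : ∀ x → Dec (Covered x)
  covered? x = map′ (λ (g , l , x∈ι) → (g , l) , x∈ι) (λ ((g , l) , x∈ι) → g , l , x∈ι)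
                    (any? λ g → any? λ l → x ∈ᶜ? (g , l))

  dnf : BoolFun n
  dnf x = does (covered? x)

  record Mismatch (x : Vec Bool n) (ι : Index) (q : Fin n) : Set where
    constructor mismatch
    field
      fixed   : Fixed ι q
      differs : lookup x q ≢ value ι q

  mismatch⇒∉ᶜ : ∀ {x ι q} → Mismatch x ι q → ¬ x ∈ᶜ ι
  mismatch⇒∉ᶜ (mismatch fixed differs) (agrees x∈ι) = differs (x∈ι _ fixed)

  ∉ᶜ⇒mismatch : ∀ {x ι} → ¬ x ∈ᶜ ι → ∃ (Mismatch x ι)
  ∉ᶜ⇒mismatch {x} {ι} x∉ι
    with ¬∀⟶∃¬ n _ (λ j → fixed? ι j →-dec (lookup x j Bool.≟ value ι j)) (x∉ι ∘ agrees)
  ... | q , ¬agrees with fixed? ι q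
  ...   | yes fixed = q , mismatch fixed λ same → ¬agrees λ _ → same
  ...   | no ¬fixed = contradiction (λ fixed → contradiction fixed ¬fixed) ¬agrees

  changed-at-mismatch : ∀ {x y ι q} → x ∈ᶜ ι → Mismatch y ι q → lookup y q ≢ lookup x q
  changed-at-mismatch (agrees x∈ι) (mismatch fixed differs) same = differs (trans same (x∈ι _ fixed))

  dnf-separates : ∀ {x y} → Covered x → ¬ Covered y → dnf x ≢ dnf y
  dnf-separates {x} {y} x∈ y∉ eq =
    contradiction (trans (sym (dec-true (covered? x) x∈)) (trans eq (dec-false (covered? y) y∉))) λ ()

  sensitive-covered : ∀ {x y} → dnf y ≢ dnf x → Covered x → ¬ Covered y
  sensitive-covered {x} {y} dnf≢ x∈ y∈ =
    dnf≢ (trans (dec-true (covered? y) y∈) (sym (dec-true (covered? x) x∈)))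

  sensitive-uncovered : ∀ {x y} → dnf y ≢ dnf x → ¬ Covered x → Covered y
  sensitive-uncovered {x} {y} dnf≢ x∉ with covered? y
  ... | yes y∈ = y∈
  ... | no  y∉ = contradiction (trans (dec-false (covered? y) y∉) (sym (dec-false (covered? x) x∉))) dnf≢

  mismatch-persists : ∀ {x ι q j} → Mismatch x ι q → q ≢ j → Mismatch (flipBit x j) ι q
  mismatch-persists {x} (mismatch fixed differs) q≢j =
    mismatch fixed (differs ∘ trans (sym (lookup-flipBit-≢ x q≢j)))

  TwoMismatches : Vec Bool n → Index → Set
  TwoMismatches x ι = ∃₂ λ q q' → q ≢ q' × Mismatch x ι q × Mismatch x ι q'

  module AtCoveredInput {ι x} (x∈ι : x ∈ᶜ ι) where

    sensitive⇒∉ᶜ : ∀ {y} → dnf y ≢ dnf x → ¬ y ∈ᶜ ι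
    sensitive⇒∉ᶜ dnf≢ y∈ι = sensitive-covered dnf≢ (ι , x∈ι) (ι , y∈ι)

    sensitive⇒fixed : ∀ {j} → j ∈ sensitiveSet dnf x → Fixed ι j
    sensitive⇒fixed j∈S with ∉ᶜ⇒mismatch (sensitive⇒∉ᶜ (j∈sensitiveSet⁻ dnf x j∈S))
    ... | q , q-mismatch@(mismatch fixed _) =
      subst (Fixed ι) (changedBy-flipBit x (changed-at-mismatch x∈ι q-mismatch)) fixed

    sensitiveBlock⇒fixed : ∀ {B} → dnf (flipBlock x B) ≢ dnf x → ∃ λ q → Fixed ι q × q ∈ B
    sensitiveBlock⇒fixed {B} dnf≢ with ∉ᶜ⇒mismatch (sensitive⇒∉ᶜ dnf≢)
    ... | q , q-mismatch@(mismatch fixed _) =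
      q , fixed , changedBy-flipBlock x B (changed-at-mismatch x∈ι q-mismatch)

    module _ {m} (cover : Fin m → Fin n) (covers : ∀ {j} → Fixed ι j → ∃ λ u → cover u ≡ j) where

      sensAt≤codim : sensAt dnf x ≤ m
      sensAt≤codim = coveredBy⇒∣p∣≤ (sensitiveSet dnf x) cover (covers ∘ sensitive⇒fixed)

      blocks≤codim : ∀ {b} → SensitiveBlocks dnf x b → b ≤ m
      blocks≤codim (B , disjoint , sensitive) =
        injective⇒≤ (disjoint⇒injective B disjoint (proj₁ ∘ hit) cover (proj₂ ∘ hit))
        where
        hit : ∀ t → ∃ λ u → cover u ∈ B t
        hit t with sensitiveBlock⇒fixed (sensitive t)
        ... | q , fixed , q∈B with covers fixed
        ...   | u , refl = u , q∈B

    module _ (isolated : ∀ ι' → ι' ≢ ι → TwoMismatches x ι') where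

      fixed⇒sensitive : ∀ {j} → Fixed ι j → j ∈ sensitiveSet dnf x
      fixed⇒sensitive {j} fixed = j∈sensitiveSet⁺ dnf x (≢-sym (dnf-separates (ι , x∈ι) flip-uncovered))
        where
        flip-uncovered : ¬ Covered (flipBit x j)
        flip-uncovered (ι' , y∈ι') with ι' ≟ᶜ ι
        ... | yes refl = mismatch⇒∉ᶜ (mismatch fixed flipped) y∈ι'
          where
          flipped : lookup (flipBit x j) j ≢ value ι j
          flipped eq = not-¬ refl (sym (trans (sym (lookup-flipBit-≡ x j))
                                         (trans eq (sym (agreement x∈ι j fixed)))))
        ... | no ι'≢ι with isolated ι' ι'≢ι
        ...   | q , q' , q≢q' , q-mismatch , q'-mismatch with q ≟ j
        ...     | yes refl = mismatch⇒∉ᶜ (mismatch-persists q'-mismatch (q≢q' ∘ sym)) y∈ι'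
        ...     | no  q≢j  = mismatch⇒∉ᶜ (mismatch-persists q-mismatch q≢j) y∈ι'

      codim≤sensAt : ∀ {m} (e : Fin m → Fin n) → Injective _≡_ _≡_ e → (∀ u → Fixed ι (e u)) →
        m ≤ sensAt dnf x
      codim≤sensAt e e-injective e-fixed =
        injectiveInto⇒≤∣p∣ (sensitiveSet dnf x) e e-injective (fixed⇒sensitive ∘ e-fixed)

  record Conflict (ι ι' : Index) (q : Fin n) : Set where
    constructor conflict
    field
      fixedˡ  : Fixed ι q
      fixedʳ  : Fixed ι' q
      differs : value ι q ≢ value ι' q

  -- No two coordinates meet every conflict: points of the two cubes are at Hamming distance at least 3.
  Separated : Index → Index → Set
  Separated ι ι' = ∀ j j' → ∃ λ q → Conflict ι ι' q × q ≢ j × q ≢ j'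

  separated-sym : ∀ {ι ι'} → Separated ι ι' → Separated ι' ι
  separated-sym separated j j' with separated j j'
  ... | q , conflict fixedˡ fixedʳ differs , q≢j , q≢j' = q , conflict fixedʳ fixedˡ (≢-sym differs) , q≢j , q≢j'

  module AtUncoveredInput {x} (x∉ : ¬ Covered x) where

    mismatchOf : ∀ ι → ∃ (Mismatch x ι)
    mismatchOf ι = ∉ᶜ⇒mismatch λ x∈ι → x∉ (ι , x∈ι)

    flipBit-hits-mismatch : ∀ {ι j} → flipBit x j ∈ᶜ ι → proj₁ (mismatchOf ι) ≡ j
    flipBit-hits-mismatch {ι} y∈ι = changedBy-flipBit x (≢-sym (changed-at-mismatch y∈ι (proj₂ (mismatchOf ι))))

    flipBlock-hits-mismatch : ∀ {ι B} → flipBlock x B ∈ᶜ ι → proj₁ (mismatchOf ι) ∈ B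
    flipBlock-hits-mismatch {ι} {B} y∈ι =
      changedBy-flipBlock x B (≢-sym (changed-at-mismatch y∈ι (proj₂ (mismatchOf ι))))

    -- Each sensitive block contains the chosen mismatch of x with the cube it flips into.
    blocks≤#cubes : ∀ {b} → SensitiveBlocks dnf x b → b ≤ G * L
    blocks≤#cubes (B , disjoint , sensitive) =
      injective⇒≤ {f = uncurry combine ∘ cubeOf} λ eq →
        cubeOf-injective (uncurry (cong₂ _,_) (combine-injective _ _ _ _ eq))
      where
      target : ∀ t → Covered (flipBlock x (B t))
      target t = sensitive-uncovered (sensitive t) x∉
      cubeOf : _ → Index
      cubeOf = proj₁ ∘ target
      cubeOf-injective : Injective _≡_ _≡_ cubeOf
      cubeOf-injective = disjoint⇒injective B disjoint cubeOf (proj₁ ∘ mismatchOf)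
                           (flipBlock-hits-mismatch ∘ proj₂ ∘ target)

    -- A sensitive coordinate is the chosen mismatch of the cube it flips into, so it lies in that cube's
    -- region; separation leaves room for only one sensitive coordinate per group.
    module _ (region : Fin n → Fin G) (fixed-in-region : ∀ {g l j} → Fixed (g , l) j → region j ≡ g)
             (separated : ∀ {g l l'} → l ≢ l' → Separated (g , l) (g , l')) where

      flips-into-own-region : ∀ {j} → j ∈ sensitiveSet dnf x → ∃ λ l → flipBit x j ∈ᶜ (region j , l)
      flips-into-own-region {j} j∈S with sensitive-uncovered (j∈sensitiveSet⁻ dnf x j∈S) x∉
      ... | (g , l) , y∈ι with region-j≡g ← fixed-in-region (subst (Fixed (g , l)) (flipBit-hits-mismatch y∈ι)
                                                             (Mismatch.fixed (proj₂ (mismatchOf (g , l)))))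
        = l , subst (λ g → flipBit x j ∈ᶜ (g , l)) (sym region-j≡g) y∈ι

      one-flip-per-group : ∀ {g l l' j j'} → flipBit x j ∈ᶜ (g , l) → flipBit x j' ∈ᶜ (g , l') → j ≡ j'
      one-flip-per-group {g} {l} {l'} {j} {j'} y∈ y'∈ with l ≟ l'
      ... | yes refl = trans (sym (flipBit-hits-mismatch y∈)) (flipBit-hits-mismatch y'∈)
      ... | no l≢l' with separated l≢l' j j'
      ...   | q , conflict fixedˡ fixedʳ differs , q≢j , q≢j' = contradiction (begin
        value (g , l) q          ≡⟨ sym (agreement y∈ q fixedˡ) ⟩
        lookup (flipBit x j) q   ≡⟨ lookup-flipBit-≢ x q≢j ⟩
        lookup x q               ≡⟨ sym (lookup-flipBit-≢ x q≢j') ⟩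
        lookup (flipBit x j') q  ≡⟨ agreement y'∈ q fixedʳ ⟩
        value (g , l') q         ∎) differs
        where open ≡-Reasoning

      sensAt≤#groups : sensAt dnf x ≤ G
      sensAt≤#groups = injectiveOn⇒∣p∣≤ (sensitiveSet dnf x) region λ j∈S j'∈S same-region →
        one-flip-per-group (proj₂ (flips-into-own-region j∈S))
          (subst (λ g → _ ∈ᶜ (g , _)) (sym same-region) (proj₂ (flips-into-own-region j'∈S)))

codim≡ : ∀ k → suc (2 * k) + suc k ≡ 3 * k + 2
codim≡ = solve-∀

inputSize≡ : ∀ k → (suc (2 * k) + suc k) * (suc (2 * k) * 2) ≡ (4 * k + 2) * (3 * k + 2)
inputSize≡ = solve-∀

cellCount≡ : ∀ k → (suc (2 * k) + suc k) * suc (2 * k) ≡ (3 * k + 2) * (2 * k + 1)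
cellCount≡ = solve-∀

module Construction (k : ℕ) where

  P : ℕ
  P = suc (2 * k)

  rotate : Fin P → Fin (suc k) → Fin P
  rotate i t = fromℕ< (m%n<n (toℕ i + toℕ t) P)

  Beats : Fin P → Fin P → Set
  Beats i p = ∃ λ t → rotate i t ≡ p

  beats? : ∀ i p → Dec (Beats i p)
  beats? i p = any? λ t → rotate i t ≟ p

  beats-refl : ∀ i → Beats i i
  beats-refl i = 0F , toℕ-injective (trans (toℕ-fromℕ< _)
    (trans (cong (_% P) (+-identityʳ (toℕ i))) (m<n⇒m%n≡m (toℕ<n i))))

  circular-gap : ∀ {a b} → a < b → b < P →
    (∃ λ t → t ≤ k × (a + t) % P ≡ b) ⊎ (∃ λ t → t ≤ k × (b + t) % P ≡ a)
  circular-gap {a} {b} a<b b<P with b ∸ a ≤? k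
  ... | yes gap≤k = inj₁ (b ∸ a , gap≤k , trans (cong (_% P) (m+[n∸m]≡n (<⇒≤ a<b))) (m<n⇒m%n≡m b<P))
  ... | no  gap≰k = inj₂ (P ∸ (b ∸ a) , backward≤k , (begin
    (b + (P ∸ (b ∸ a))) % P ≡⟨ cong (_% P) wraps ⟩
    (a + P) % P             ≡⟨ [m+n]%n≡m%n a P ⟩
    a % P                   ≡⟨ m<n⇒m%n≡m (<-trans a<b b<P) ⟩
    a                       ∎))
    where
    open ≡-Reasoning
    backward≤k : P ∸ (b ∸ a) ≤ k
    backward≤k = ≤-trans (∸-monoʳ-≤ P (≰⇒> gap≰k)) (≤-reflexive (trans (m+n∸m≡n k (k + 0)) (+-identityʳ k)))
    wraps : b + (P ∸ (b ∸ a)) ≡ a + P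
    wraps = begin
      b + (P ∸ (b ∸ a))           ≡⟨ cong (_+ (P ∸ (b ∸ a))) (m+[n∸m]≡n (<⇒≤ a<b)) ⟨
      a + (b ∸ a) + (P ∸ (b ∸ a)) ≡⟨ +-assoc a (b ∸ a) _ ⟩
      a + (b ∸ a + (P ∸ (b ∸ a))) ≡⟨ cong (a +_) (m+[n∸m]≡n (≤-trans (m∸n≤m b a) (<⇒≤ b<P))) ⟩
      a + P                       ∎

  gap⇒beats : ∀ {i j} → (∃ λ t → t ≤ k × (toℕ i + t) % P ≡ toℕ j) → Beats i j
  gap⇒beats {i} {j} (t , t≤k , i+t≡j) = fromℕ< (s≤s t≤k) , toℕ-injective (begin
    toℕ (rotate i (fromℕ< (s≤s t≤k)))   ≡⟨ toℕ-fromℕ< _ ⟩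
    (toℕ i + toℕ (fromℕ< (s≤s t≤k))) % P ≡⟨ cong (λ t → (toℕ i + t) % P) (toℕ-fromℕ< (s≤s t≤k)) ⟩
    (toℕ i + t) % P                     ≡⟨ i+t≡j ⟩
    toℕ j                               ∎)
    where open ≡-Reasoning

  beats-total : ∀ {i j} → i ≢ j → Beats i j ⊎ Beats j i
  beats-total {i} {j} i≢j with <-cmp (toℕ i) (toℕ j)
  ... | tri< i<j _ _ = ⊎-map (gap⇒beats {i} {j}) (gap⇒beats {j} {i}) (circular-gap i<j (toℕ<n j))
  ... | tri≈ _ i≡j _ = contradiction (toℕ-injective i≡j) i≢j
  ... | tri> _ _ j<i = swap (⊎-map (gap⇒beats {j} {i}) (gap⇒beats {i} {j}) (circular-gap j<i (toℕ<n i)))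

  M : ℕ
  M = P + suc k

  N : ℕ
  N = (4 * k + 2) * (3 * k + 2)

  N≡ : M * (P * 2) ≡ N
  N≡ = inputSize≡ k

  Coord : Set
  Coord = Fin M × Fin P × Fin 2

  coord : Coord → Fin N
  coord (c , p , b) = cast N≡ (combine c (combine p b))

  uncoord : Fin N → Coord
  uncoord j = map₂ (remQuot {P} 2) (remQuot {M} (P * 2) (cast (sym N≡) j))

  uncoord-coord : ∀ a → uncoord (coord a) ≡ a
  uncoord-coord (c , p , b) = begin
    uncoord (coord (c , p , b))
      ≡⟨ cong (λ j → map₂ (remQuot {P} 2) (remQuot {M} (P * 2) j)) (cast-involutive (sym N≡) N≡ _) ⟩
    map₂ (remQuot {P} 2) (remQuot {M} (P * 2) (combine c (combine p b)))
      ≡⟨ cong (map₂ (remQuot {P} 2)) (remQuot-combine c _) ⟩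
    c , remQuot {P} 2 (combine p b)
      ≡⟨ cong (c ,_) (remQuot-combine p b) ⟩
    c , p , b ∎
    where open ≡-Reasoning

  coord-uncoord : ∀ j → coord (uncoord j) ≡ j
  coord-uncoord j = begin
    cast N≡ (combine c (uncurry combine (remQuot {P} 2 r)))
      ≡⟨ cong (λ r → cast N≡ (combine c r)) (combine-remQuot {P} 2 r) ⟩
    cast N≡ (uncurry combine (remQuot {M} (P * 2) j′))
      ≡⟨ cong (cast N≡) (combine-remQuot {M} (P * 2) j′) ⟩
    cast N≡ j′
      ≡⟨ cast-involutive N≡ (sym N≡) j ⟩
    j ∎
    where
    open ≡-Reasoning
    j′ = cast (sym N≡) j
    c = proj₁ (remQuot {M} (P * 2) j′)
    r = proj₂ (remQuot {M} (P * 2) j′)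

  coord-injective : ∀ {a a'} → coord a ≡ coord a' → a ≡ a'
  coord-injective {a} {a'} eq = trans (sym (uncoord-coord a)) (trans (cong uncoord eq) (uncoord-coord a'))

  copy : Fin N → Fin M
  copy j = proj₁ (uncoord j)

  player : Fin N → Fin P
  player j = proj₁ (proj₂ (uncoord j))

  bit : Fin N → Fin 2
  bit j = proj₂ (proj₂ (uncoord j))

  Cell : Set
  Cell = Fin M × Fin P

  -- Coordinate (c , p , b) is bit b of player p in copy c. The cube of cell (c , i) fixes bit 1 of every
  -- player of copy c and bit 0 of every player beaten by i, each to [p = i]; cover enumerates these
  -- P + (k + 1) fixed coordinates.
  FixedAt : Cell → Coord → Set
  FixedAt (c , i) (c' , p , b) = c' ≡ c × (b ≡ 1F ⊎ Beats i p)

  Fixed : Cell → Fin N → Set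
  Fixed ι j = FixedAt ι (uncoord j)

  fixed? : ∀ ι j → Dec (Fixed ι j)
  fixed? (c , i) j = (copy j ≟ c) ×-dec ((bit j ≟ 1F) ⊎-dec beats? i (player j))

  value : Cell → Fin N → Bool
  value (c , i) j = does (player j ≟ i)

  open Subcubes Fixed fixed? value public

  fixed-coord : ∀ {c i p b} → b ≡ 1F ⊎ Beats i p → Fixed (c , i) (coord (c , p , b))
  fixed-coord {c} {i} {p} {b} fixed = subst (FixedAt (c , i)) (sym (uncoord-coord (c , p , b))) (refl , fixed)

  value-coord : ∀ ι a → value ι (coord a) ≡ does (proj₁ (proj₂ a) ≟ proj₂ ι)
  value-coord (_ , i) a = cong (λ a → does (proj₁ (proj₂ a) ≟ i)) (uncoord-coord a)

  position : Fin P → Fin P ⊎ Fin (suc k) → Fin P × Fin 2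
  position i = [ (λ p → p , 1F) , (λ t → rotate i t , 0F) ]′

  cover : Cell → Fin M → Fin N
  cover (c , i) u = coord (c , position i (splitAt P u))

  position-fixed : ∀ i s → proj₂ (position i s) ≡ 1F ⊎ Beats i (proj₁ (position i s))
  position-fixed i (inj₁ p) = inj₁ refl
  position-fixed i (inj₂ t) = inj₂ (t , refl)

  position-onto : ∀ {i p b} → b ≡ 1F ⊎ Beats i p → ∃ λ s → position i s ≡ (p , b)
  position-onto {b = 1F} _                 = inj₁ _ , refl
  position-onto {b = 0F} (inj₂ (t , refl)) = inj₂ t , refl

  cover-fixed : ∀ ι u → Fixed ι (cover ι u)
  cover-fixed (c , i) u = fixed-coord {i = i} (position-fixed i (splitAt P u))

  covers : ∀ {ι j} → Fixed ι j → ∃ λ u → cover ι u ≡ j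
  covers {c , i} {j} (refl , fixed) = preimage (position-onto {i = i} fixed)
    where
    open ≡-Reasoning
    preimage : (∃ λ s → position i s ≡ (player j , bit j)) → ∃ λ u → cover (copy j , i) u ≡ j
    preimage (s , position≡) = join P (suc k) s , (begin
      coord (copy j , position i (splitAt P (join P (suc k) s))) ≡⟨ cong (λ s → coord (copy j , position i s)) (splitAt-join P (suc k) s) ⟩
      coord (copy j , position i s)                              ≡⟨ cong (λ pb → coord (copy j , pb)) position≡ ⟩
      coord (uncoord j)                                          ≡⟨ coord-uncoord j ⟩
      j                                                          ∎)

  rotate-zero-injective : ∀ {t t'} → rotate 0F t ≡ rotate 0F t' → t ≡ t'
  rotate-zero-injective {t} {t'} eq = toℕ-injective (begin
    toℕ t              ≡⟨ toℕ-rotate-zero t ⟨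
    toℕ (rotate 0F t)  ≡⟨ cong toℕ eq ⟩
    toℕ (rotate 0F t') ≡⟨ toℕ-rotate-zero t' ⟩
    toℕ t'             ∎)
    where
    open ≡-Reasoning
    toℕ-rotate-zero : ∀ t → toℕ (rotate 0F t) ≡ toℕ t
    toℕ-rotate-zero t = trans (toℕ-fromℕ< _) (m<n⇒m%n≡m (<-≤-trans (toℕ<n t) (s≤s (m≤m+n k (1 * k)))))

  position-zero-injective : ∀ {s s'} → position 0F s ≡ position 0F s' → s ≡ s'
  position-zero-injective {inj₁ p} {inj₁ p'} eq = cong (inj₁ ∘ proj₁) eq
  position-zero-injective {inj₂ t} {inj₂ t'} eq = cong inj₂ (rotate-zero-injective (cong proj₁ eq))
  position-zero-injective {inj₁ p} {inj₂ t'} ()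
  position-zero-injective {inj₂ t} {inj₁ p'} ()

  cover-origin-injective : Injective _≡_ _≡_ (cover (0F , 0F))
  cover-origin-injective {u} {u'} eq = begin
    u                              ≡⟨ join-splitAt P (suc k) u ⟨
    join P (suc k) (splitAt P u)   ≡⟨ cong (join P (suc k)) (position-zero-injective {splitAt P u} {splitAt P u'} (cong proj₂ coords≡)) ⟩
    join P (suc k) (splitAt P u')  ≡⟨ join-splitAt P (suc k) u' ⟩
    u'                             ∎
    where
    open ≡-Reasoning
    coords≡ : (0F , position 0F (splitAt P u)) ≡ (0F , position 0F (splitAt P u'))
    coords≡ = coord-injective eq

  value-home : ∀ c c' i b → value (c , i) (coord (c' , i , b)) ≡ true
  value-home c c' i b = trans (value-coord (c , i) (c' , i , b)) (dec-true (i ≟ i) refl)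

  value-away : ∀ c c' {i p} b → p ≢ i → value (c , i) (coord (c' , p , b)) ≡ false
  value-away c c' {i} {p} b p≢i = trans (value-coord (c , i) (c' , p , b)) (dec-false (p ≟ i) p≢i)

  fixed-home : ∀ c i b → Fixed (c , i) (coord (c , i , b))
  fixed-home c i b = fixed-coord {c} {i} {i} {b} (inj₂ (beats-refl i))

  coord-≢ : ∀ {a a'} → a ≢ a' → coord a ≢ coord a'
  coord-≢ {a} {a'} a≢a' eq = a≢a' (coord-injective {a} {a'} eq)

  separated-beaten : ∀ {c i i'} → i ≢ i' → Beats i' i → Separated (c , i) (c , i')
  separated-beaten {c} {i} {i'} i≢i' beaten =
    avoid-two _≟_ (coord-≢ {c , i , 0F} {c , i , 1F} (λ ())) (coord-≢ {c , i , 0F} {c , i' , 1F} player-differs)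
      (coord-≢ {c , i , 1F} {c , i' , 1F} player-differs) conflict-home₀ conflict-home₁ conflict-away₁
    where
    player-differs : ∀ {b b'} → (c , i , b) ≢ (c , i' , b')
    player-differs = i≢i' ∘ cong (proj₁ ∘ proj₂)
    conflict-home₀ : Conflict (c , i) (c , i') (coord (c , i , 0F))
    conflict-home₀ = conflict (fixed-home c i 0F) (fixed-coord {c} {i'} {i} {0F} (inj₂ beaten)) λ eq →
      contradiction (trans (sym (value-home c c i 0F)) (trans eq (value-away c c 0F i≢i'))) λ ()
    conflict-home₁ : Conflict (c , i) (c , i') (coord (c , i , 1F))
    conflict-home₁ = conflict (fixed-home c i 1F) (fixed-coord {c} {i'} {i} {1F} (inj₁ refl)) λ eq →
      contradiction (trans (sym (value-home c c i 1F)) (trans eq (value-away c c 1F i≢i'))) λ ()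
    conflict-away₁ : Conflict (c , i) (c , i') (coord (c , i' , 1F))
    conflict-away₁ = conflict (fixed-coord {c} {i} {i'} {1F} (inj₁ refl)) (fixed-home c i' 1F) λ eq →
      contradiction (trans (sym (value-away c c 1F (i≢i' ∘ sym))) (trans eq (value-home c c i' 1F))) λ ()

  separated : ∀ {c i i'} → i ≢ i' → Separated (c , i) (c , i')
  separated {c} {i} {i'} i≢i' = [ (λ i-beats → separated-sym (separated-beaten (i≢i' ∘ sym) i-beats))
                                , separated-beaten i≢i' ]′ (beats-total i≢i')

  cell : Fin N → Cell
  cell j = copy j , player j

  cell-coord : ∀ a → cell (coord a) ≡ (proj₁ a , proj₁ (proj₂ a))
  cell-coord a = cong (λ (c , p , _) → c , p) (uncoord-coord a)

  block : Cell → Subset N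
  block ι = tabulate λ j → does (cell j ≟ᶜ ι)

  ∈block : ∀ {ι j} → j ∈ block ι → cell j ≡ ι
  ∈block {ι} {j} j∈ = invert (subst (Reflects _) lookup≡true (proof (cell j ≟ᶜ ι)))
    where
    lookup≡true : does (cell j ≟ᶜ ι) ≡ true
    lookup≡true = trans (sym (lookup∘tabulate _ j)) ([]=⇒lookup j∈)

  block-∈ᶜ : ∀ ι → block ι ∈ᶜ ι
  block-∈ᶜ (c , i) = agrees λ j (copy≡c , _) → trans (lookup∘tabulate _ j)
    (does-⇔ (mk⇔ (cong proj₂) (cong₂ _,_ copy≡c)) (cell j ≟ᶜ (c , i)) (player j ≟ i))

  home-mismatch : ∀ {x} c i b → lookup x (coord (c , i , b)) ≡ false → Mismatch x (c , i) (coord (c , i , b))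
  home-mismatch c i b x≡false =
    mismatch (fixed-home c i b) λ eq → contradiction (trans (sym x≡false) (trans eq (value-home c c i b))) λ ()

  block-isolated : ∀ ι ι' → ι' ≢ ι → TwoMismatches (block ι) ι'
  block-isolated ι (c , i) ι'≢ι =
    coord (c , i , 0F) , coord (c , i , 1F) , coord-≢ {c , i , 0F} {c , i , 1F} (λ ()) ,
    home-mismatch c i 0F (off-block 0F) , home-mismatch c i 1F (off-block 1F)
    where
    off-block : ∀ b → lookup (block ι) (coord (c , i , b)) ≡ false
    off-block b = trans (lookup∘tabulate _ (coord (c , i , b)))
                    (dec-false (cell (coord (c , i , b)) ≟ᶜ ι) (ι'≢ι ∘ trans (sym (cell-coord (c , i , b)))))

  zeros : Vec Bool N
  zeros = replicate N false

  zeros-uncovered : ¬ Covered zeros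
  zeros-uncovered ((c , i) , zeros∈) = mismatch⇒∉ᶜ (home-mismatch c i 0F (lookup-replicate (coord (c , i , 0F)) false)) zeros∈

  block-disjoint : ∀ {ι ι'} → ι ≢ ι' → block ι ∩ block ι' ≡ ∅
  block-disjoint {ι} {ι'} ι≢ι' = Empty-unique λ (q , q∈) →
    ι≢ι' (trans (sym (∈block {ι} (proj₁ (x∈p∩q⁻ _ _ q∈)))) (∈block {ι'} (proj₂ (x∈p∩q⁻ _ _ q∈))))

  flipBlock-zeros : ∀ B → flipBlock zeros B ≡ B
  flipBlock-zeros = zipWith-identityˡ xor-identityˡ

  blocks-at-zeros : SensitiveBlocks dnf zeros (M * P)
  blocks-at-zeros = block ∘ remQuot {M} P ,
    (λ t t' t≢t' → block-disjoint (t≢t' ∘ remQuot-injective)) ,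
    (λ t → dnf-separates (remQuot P t , subst (_∈ᶜ remQuot P t) (sym (flipBlock-zeros _)) (block-∈ᶜ _)) zeros-uncovered)
    where
    remQuot-injective : ∀ {t t'} → remQuot {M} P t ≡ remQuot P t' → t ≡ t'
    remQuot-injective {t} {t'} eq = begin
      t                                   ≡⟨ combine-remQuot {M} P t ⟨
      uncurry combine (remQuot {M} P t)   ≡⟨ cong (uncurry combine) eq ⟩
      uncurry combine (remQuot {M} P t')  ≡⟨ combine-remQuot {M} P t' ⟩
      t'                                  ∎
      where open ≡-Reasoning

  sensAt≤M : ∀ x → sensAt dnf x ≤ M
  sensAt≤M x = bound (covered? x)
    where
    bound : Dec (Covered x) → sensAt dnf x ≤ M
    bound (yes (ι , x∈ι)) = AtCoveredInput.sensAt≤codim x∈ι (cover ι) (covers {ι})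
    bound (no  x∉)       = AtUncoveredInput.sensAt≤#groups x∉ copy proj₁ separated

  blocks≤M*P : ∀ x {b} → SensitiveBlocks dnf x b → b ≤ M * P
  blocks≤M*P x {b} = bound (covered? x)
    where
    bound : Dec (Covered x) → SensitiveBlocks dnf x b → b ≤ M * P
    bound (yes (ι , x∈ι)) blocks = ≤-trans (AtCoveredInput.blocks≤codim x∈ι (cover ι) (covers {ι}) blocks) (m≤m*n M P)
    bound (no  x∉)       = AtUncoveredInput.blocks≤#cubes x∉

  sensAt-origin : sensAt dnf (block (0F , 0F)) ≡ M
  sensAt-origin = ≤-antisym (sensAt≤M (block origin))
    (AtCoveredInput.codim≤sensAt (block-∈ᶜ origin) (block-isolated origin) (cover origin) cover-origin-injective
      (cover-fixed origin))
    where origin = 0F , 0F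

theorem1 : (k : ℕ) →
    Σ (BoolFun ((4 * k + 2) * (3 * k + 2))) (λ f →
      SensitivityIs f (3 * k + 2) × BlockSensitivityIs f ((3 * k + 2) * (2 * k + 1)))
theorem1 k = dnf ,
  subst (SensitivityIs dnf) (codim≡ k) (sensitivity-intro {f = dnf} (block (0F , 0F)) sensAt-origin sensAt≤M) ,
  subst (BlockSensitivityIs dnf) (cellCount≡ k) (blockSensitivity-intro {f = dnf} zeros blocks-at-zeros blocks≤M*P)
  where open Construction k
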